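{- Let $A$ be an alphabet with $q=3$ letters, and for $n\geq 1$ let $M_3(n)=3^{ -n}\sum_{w\in A^n}P(w)$, where $P(w)$ is the number of distinct nonempty palindromes occurring as factors of $w$. Then $$\limsup_{n\to\infty}\frac{M_3(n)}{n}<1.$$
   Context: $A^n$ is the set of words of length $n$ over $A$. A word is a palindrome if it equals its reversal; a factor is a block of consecutive letters of a word. -}

module Defs where

open import Data.Nat using (ℕ; zero; suc; _+_)
open import Data.Fin using (Fin)
import Data.Fin.Properties as FinP
open import Data.List using (List; []; _∷_; [_]; map; concatMap; inits; tails; filter; deduplicate; reverse; length; allFin)
open import Data.Nat.ListAction using (sum)
open import Data.List.Properties using (≡-dec)
open import Relation.Binary.PropositionalEquality using (_≡_)
open import Relation.Nullary using (Dec; ¬_; ¬?)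
open import Relation.Binary using (DecidableEquality)

Letter : Set
Letter = Fin 3

Word : Set
Word = List Letter

_≟w_ : DecidableEquality Word
_≟w_ = ≡-dec FinP._≟_

allWords : ℕ → List Word
allWords zero = [ [] ]
allWords (suc n) = concatMap (λ w → map (_∷ w) (allFin 3)) (allWords n)

IsPalindrome : Word → Set
IsPalindrome w = w ≡ reverse w

isPalindrome? : (w : Word) → Dec (IsPalindrome w)
isPalindrome? w = w ≟w reverse w

NonEmpty : Word → Set
NonEmpty w = ¬ (w ≡ [])

nonEmpty? : (w : Word) → Dec (NonEmpty w)
nonEmpty? w = ¬? (w ≟w [])

factors : Word → List Word
factors w = concatMap inits (tails w)

P : Word → ℕ
P w = length (deduplicate _≟w_ (filter isPalindrome? (filter nonEmpty? (factors w))))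

-- S(n) = Σ_{w ∈ A^n} P(w) = 3^n · M_3(n).
S : ℕ → ℕ
S n = sum (map P (allWords n))

module Submission where

-- Every word u over the three-letter alphabet has at most six distinct nonempty palindromic
-- factors of length at most 2 (a and aa for each letter a), so P(u) ≤ 6 + occ(u), where
-- occ(u) counts the occurrences (start position, length) of palindromic factors of length ≥ 3.
-- The theorem then follows from the average bound  3 · Σ_{u ∈ A^n} occ(u) ≤ 2 · n · 3^n :
-- it gives 6 · S(n) ≤ 36 · 3^n + 4 · n · 3^n ≤ 5 · n · 3^n for n ≥ 36, i.e. limsup M₃(n)/n ≤ 5/6.
--
-- A word x·p·z is a palindrome only if x = z
-- and p is a palindrome; hence, summed over the first letter x, the palindromic prefixes of
-- length ≥ j + 2 of the words x·w are no more than the palindromic prefixes of length ≥ j of w.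
-- Iterating it shows that the words of A^n have at most 2 · 3^n nonempty palindromic prefixes
-- in total, and that the occurrence totals satisfy occ(n+1) ≤ 2 · 3^n + 3 · occ(n).

open import Defs
open import Data.Nat using (ℕ; _*_; _^_; _≤_; _<_)
open import Data.Product using (Σ; _×_)

open import Level using (Level)
open import Data.Nat using (zero; suc; _+_; z≤n; s≤s; _≤?_)
open import Data.Nat.Properties
open import Data.Nat.Tactic.RingSolver using (solve-∀)
open import Data.Nat.ListAction using (sum)
open import Data.Nat.ListAction.Properties using (sum-++)
open import Data.Fin using () renaming (_≟_ to _≟ᶠ_)
open import Data.Fin.Patterns using (0F; 1F; 2F)
open import Data.List using (List; []; _∷_; [_]; map; concatMap; inits; tails; filter; deduplicate; reverse; length; _++_; _∷ʳ_)
import Data.List.Properties as List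
open import Data.List.Membership.Propositional using (_∈_)
open import Data.List.Membership.Propositional.Properties using (∈-∃++; ∈-++⁻; ∈-++⁺ˡ; ∈-++⁺ʳ; ∈-filter⁻; ∈-filter⁺; ∈-deduplicate⁻)
open import Data.List.Relation.Unary.Any using (here; there)
import Data.List.Relation.Unary.All as All
open import Data.List.Relation.Unary.AllPairs using (_∷_)
open import Data.List.Relation.Unary.Unique.Propositional using (Unique)
open import Data.List.Relation.Unary.Unique.DecPropositional.Properties _≟w_ using (deduplicate-!)
open import Data.Product using (_,_; proj₁; proj₂)
open import Data.Sum using (inj₁; inj₂)
open import Data.Empty using (⊥-elim)
open import Relation.Nullary using (Dec; yes; no; ¬_)
open import Relation.Nullary.Decidable using (_×-dec_)
open import Relation.Unary using (Pred; Decidable)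
open import Relation.Binary.PropositionalEquality using (_≡_; refl; sym; trans; cong; cong₂; module ≡-Reasoning)
open import Algebra.Properties.CommutativeSemigroup +-commutativeSemigroup using (interchange)

private variable
  a b c : Level
  A : Set a
  B : Set b
  C : Set c

𝟙 : Dec A → ℕ
𝟙 (yes _) = 1
𝟙 (no _)  = 0

𝟙≤1 : (d : Dec A) → 𝟙 d ≤ 1
𝟙≤1 (yes _) = ≤-refl
𝟙≤1 (no _)  = z≤n

𝟙-true : (d : Dec A) → A → 𝟙 d ≡ 1
𝟙-true (yes _) _ = refl
𝟙-true (no ¬a) a = ⊥-elim (¬a a)

𝟙-mono : (A → B) → (d : Dec A) (e : Dec B) → 𝟙 d ≤ 𝟙 e
𝟙-mono f (yes _) (yes _) = ≤-refl
𝟙-mono f (yes a) (no ¬b) = ⊥-elim (¬b (f a))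
𝟙-mono f (no _)  _       = z≤n

𝟙-mono-× : (A → B × C) → (d : Dec A) (e : Dec B) (f : Dec C) → 𝟙 d ≤ 𝟙 e * 𝟙 f
𝟙-mono-× h (no _)  _       _       = z≤n
𝟙-mono-× h (yes _) (yes _) (yes _) = ≤-refl
𝟙-mono-× h (yes a) (no ¬b) _       = ⊥-elim (¬b (proj₁ (h a)))
𝟙-mono-× h (yes a) (yes _) (no ¬c) = ⊥-elim (¬c (proj₂ (h a)))

sum-map-mono : {f g : A → ℕ} → (∀ x → f x ≤ g x) → ∀ xs → sum (map f xs) ≤ sum (map g xs)
sum-map-mono f≤g []       = z≤n
sum-map-mono f≤g (x ∷ xs) = +-mono-≤ (f≤g x) (sum-map-mono f≤g xs)

sum-map-+ : (f g : A → ℕ) → ∀ xs → sum (map (λ x → f x + g x) xs) ≡ sum (map f xs) + sum (map g xs)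
sum-map-+ f g []       = refl
sum-map-+ f g (x ∷ xs) =
  trans (cong (f x + g x +_) (sum-map-+ f g xs)) (interchange (f x) (g x) _ _)

sum-map-* : (k : ℕ) (f : A → ℕ) → ∀ xs → sum (map (λ x → k * f x) xs) ≡ k * sum (map f xs)
sum-map-* k f []       = sym (*-zeroʳ k)
sum-map-* k f (x ∷ xs) =
  trans (cong (k * f x +_) (sum-map-* k f xs)) (sym (*-distribˡ-+ k (f x) _))

sum-map-concatMap : (f : B → ℕ) (g : A → List B) → ∀ xs →
  sum (map f (concatMap g xs)) ≡ sum (map (λ x → sum (map f (g x))) xs)
sum-map-concatMap f g []       = refl
sum-map-concatMap f g (x ∷ xs) = begin
  sum (map f (g x ++ concatMap g xs))                ≡⟨ cong sum (List.map-++ f (g x) _) ⟩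
  sum (map f (g x) ++ map f (concatMap g xs))         ≡⟨ sum-++ (map f (g x)) _ ⟩
  sum (map f (g x)) + sum (map f (concatMap g xs))   ≡⟨ cong (sum (map f (g x)) +_) (sum-map-concatMap f g xs) ⟩
  sum (map f (g x)) + sum (map (λ y → sum (map f (g y))) xs) ∎
  where open ≡-Reasoning

module _ {p} {P : Pred A p} (P? : Decidable P) where

  sum-map-filter-≤ : (h : A → ℕ) → ∀ xs → sum (map h (filter P? xs)) ≤ sum (map h xs)
  sum-map-filter-≤ h []       = z≤n
  sum-map-filter-≤ h (x ∷ xs) with P? x
  ... | yes _ = +-monoʳ-≤ (h x) (sum-map-filter-≤ h xs)
  ... | no _  = ≤-trans (sum-map-filter-≤ h xs) (m≤n+m _ (h x))

  length-filter-≤-sum : (h : A → ℕ) → ∀ xs → (∀ {x} → x ∈ xs → P x → 1 ≤ h x) →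
    length (filter P? xs) ≤ sum (map h xs)
  length-filter-≤-sum h []       _     = z≤n
  length-filter-≤-sum h (x ∷ xs) h≥1 with P? x
  ... | yes px = +-mono-≤ (h≥1 (here refl) px) (length-filter-≤-sum h xs (λ i → h≥1 (there i)))
  ... | no _   = ≤-trans (length-filter-≤-sum h xs (λ i → h≥1 (there i))) (m≤n+m _ (h x))

unique-⊆-length : {xs ys : List A} → Unique xs → (∀ {y} → y ∈ xs → y ∈ ys) → length xs ≤ length ys
unique-⊆-length {xs = []}     _            _   = z≤n
unique-⊆-length {xs = x ∷ xs} (x∉xs ∷ uxs) sub with ∈-∃++ (sub (here refl))
... | as , bs , refl = begin
  suc (length xs)            ≤⟨ s≤s (unique-⊆-length uxs sub′) ⟩
  suc (length (as ++ bs))    ≡⟨ cong suc (List.length-++ as) ⟩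
  suc (length as + length bs) ≡⟨ sym (+-suc (length as) (length bs)) ⟩
  length as + length (x ∷ bs) ≡⟨ sym (List.length-++ as) ⟩
  length (as ++ x ∷ bs)      ∎
  where
  open ≤-Reasoning
  sub′ : ∀ {y} → y ∈ xs → y ∈ as ++ bs
  sub′ y∈xs with ∈-++⁻ as (sub (there y∈xs))
  ... | inj₁ y∈as         = ∈-++⁺ˡ y∈as
  ... | inj₂ (here refl)  = ⊥-elim (All.lookup x∉xs y∈xs refl)
  ... | inj₂ (there y∈bs) = ∈-++⁺ʳ as y∈bs

ΣWords : ℕ → (Word → ℕ) → ℕ
ΣWords n f = sum (map f (allWords n))

ΣLetter : (Letter → ℕ) → ℕ
ΣLetter h = h 0F + (h 1F + (h 2F + 0))

ΣLetter-mono : {f g : Letter → ℕ} → (∀ x → f x ≤ g x) → ΣLetter f ≤ ΣLetter g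
ΣLetter-mono f≤g = +-mono-≤ (f≤g 0F) (+-mono-≤ (f≤g 1F) (+-mono-≤ (f≤g 2F) z≤n))

ΣLetter-+ : (f g : Letter → ℕ) → ΣLetter (λ x → f x + g x) ≡ ΣLetter f + ΣLetter g
ΣLetter-+ f g = rearrange (f 0F) (f 1F) (f 2F) (g 0F) (g 1F) (g 2F)
  where
  rearrange : ∀ a b c d e h → a + d + (b + e + (c + h + 0)) ≡ a + (b + (c + 0)) + (d + (e + (h + 0)))
  rearrange = solve-∀

ΣLetter-≟ : ∀ z k → ΣLetter (λ x → 𝟙 (x ≟ᶠ z) * k) ≡ k
ΣLetter-≟ 0F k = trans (+-identityʳ _) (+-identityʳ k)
ΣLetter-≟ 1F k = trans (+-identityʳ _) (+-identityʳ k)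
ΣLetter-≟ 2F k = trans (+-identityʳ _) (+-identityʳ k)

ΣWords-suc : ∀ n f → ΣWords (suc n) f ≡ ΣWords n (λ w → ΣLetter (λ x → f (x ∷ w)))
ΣWords-suc n f = sum-map-concatMap f _ (allWords n)

ΣWords-mono : ∀ n {f g : Word → ℕ} → (∀ w → f w ≤ g w) → ΣWords n f ≤ ΣWords n g
ΣWords-mono n f≤g = sum-map-mono f≤g (allWords n)

ΣWords-+ : ∀ n (f g : Word → ℕ) → ΣWords n (λ w → f w + g w) ≡ ΣWords n f + ΣWords n g
ΣWords-+ n f g = sum-map-+ f g (allWords n)

ΣWords-* : ∀ n k (f : Word → ℕ) → ΣWords n (λ w → k * f w) ≡ k * ΣWords n f
ΣWords-* n k f = sum-map-* k f (allWords n)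

ΣWords-const : ∀ n k → ΣWords n (λ _ → k) ≡ k * 3 ^ n
ΣWords-const zero    k = trans (+-identityʳ k) (sym (*-identityʳ k))
ΣWords-const (suc n) k = begin
  ΣWords (suc n) (λ _ → k) ≡⟨ ΣWords-suc n (λ _ → k) ⟩
  ΣWords n (λ _ → 3 * k)   ≡⟨ ΣWords-const n (3 * k) ⟩
  3 * k * 3 ^ n            ≡⟨ rearrange k (3 ^ n) ⟩
  k * 3 ^ suc n            ∎
  where
  open ≡-Reasoning
  rearrange : ∀ k t → 3 * k * t ≡ k * (3 * t)
  rearrange = solve-∀

Σprefixes : (Word → ℕ) → Word → ℕ
Σprefixes f []      = 0
Σprefixes f (y ∷ w) = f [ y ] + Σprefixes (λ q → f (y ∷ q)) w

-- Σpositions f w = Σ_{i < |w|} f (w₀ ⋯ w_{i-1}) wᵢ : a sum over the positions of w that sees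
-- the prefix before the position and the letter at it.
Σpositions : (Word → Letter → ℕ) → Word → ℕ
Σpositions f []      = 0
Σpositions f (y ∷ w) = f [] y + Σpositions (λ p z → f (y ∷ p) z) w

-- Each nonempty prefix is p ++ [ z ] for a unique position with prefix p and letter z.
Σprefixes-as-positions : ∀ f w → Σprefixes f w ≡ Σpositions (λ p z → f (p ++ [ z ])) w
Σprefixes-as-positions f []      = refl
Σprefixes-as-positions f (y ∷ w) = cong (f [ y ] +_) (Σprefixes-as-positions (λ q → f (y ∷ q)) w)

-- Forgetting the letter: the prefixes before the positions are [] and the proper nonempty prefixes.
Σpositions-forget : ∀ f w → Σpositions (λ p _ → f p) w ≤ f [] + Σprefixes f w
Σpositions-forget f []      = z≤n
Σpositions-forget f (y ∷ w) = +-monoʳ-≤ (f []) (Σpositions-forget (λ q → f (y ∷ q)) w)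

Σprefixes-mono : {f g : Word → ℕ} → (∀ y q → f (y ∷ q) ≤ g (y ∷ q)) → ∀ w → Σprefixes f w ≤ Σprefixes g w
Σprefixes-mono f≤g []      = z≤n
Σprefixes-mono f≤g (y ∷ w) = +-mono-≤ (f≤g y []) (Σprefixes-mono (λ y′ q → f≤g y (y′ ∷ q)) w)

Σpositions-mono : {f g : Word → Letter → ℕ} → (∀ p z → f p z ≤ g p z) → ∀ w → Σpositions f w ≤ Σpositions g w
Σpositions-mono f≤g []      = z≤n
Σpositions-mono f≤g (y ∷ w) = +-mono-≤ (f≤g [] y) (Σpositions-mono (λ p z → f≤g (y ∷ p) z) w)

Σpositions-ΣLetter : ∀ (f : Letter → Word → Letter → ℕ) w →
  ΣLetter (λ x → Σpositions (f x) w) ≡ Σpositions (λ p z → ΣLetter (λ x → f x p z)) w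
Σpositions-ΣLetter f []      = refl
Σpositions-ΣLetter f (y ∷ w) =
  trans (ΣLetter-+ (λ x → f x [] y) (λ x → Σpositions (λ p z → f x (y ∷ p) z) w))
        (cong (ΣLetter (λ x → f x [] y) +_) (Σpositions-ΣLetter (λ x p z → f x (y ∷ p) z) w))

sum-inits : ∀ (f : Word → ℕ) w → sum (map f (inits w)) ≡ f [] + Σprefixes f w
sum-inits f []      = refl
sum-inits f (y ∷ w) = cong (f [] +_) (begin
  sum (map f (map (y ∷_) (inits w))) ≡⟨ cong sum (sym (List.map-∘ (inits w))) ⟩
  sum (map (λ q → f (y ∷ q)) (inits w)) ≡⟨ sum-inits (λ q → f (y ∷ q)) w ⟩
  f [ y ] + Σprefixes (λ q → f (y ∷ q)) w ∎)
  where open ≡-Reasoning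

longPal : ℕ → Word → ℕ
longPal j q = 𝟙 ((j ≤? length q) ×-dec isPalindrome? q)

longPal-raise : ∀ j k q → k ≤ length q → longPal j q ≤ longPal k q
longPal-raise j k q k≤|q| =
  𝟙-mono (λ (_ , pal) → k≤|q| , pal) ((j ≤? length q) ×-dec isPalindrome? q) ((k ≤? length q) ×-dec isPalindrome? q)

longPal-hit : ∀ j q → j ≤ length q → IsPalindrome q → 1 ≤ longPal j q
longPal-hit j q long pal = ≤-reflexive (sym (𝟙-true ((j ≤? length q) ×-dec isPalindrome? q) (long , pal)))

palPrefixes : ℕ → Word → ℕ
palPrefixes j = Σprefixes (longPal j)

palindrome-peel : ∀ x p z → IsPalindrome (x ∷ p ++ [ z ]) → x ≡ z × IsPalindrome p
palindrome-peel x p z pal = x≡z , List.∷ʳ-injectiveˡ p (reverse p) (trans p∷ʳz≡ (cong (reverse p ∷ʳ_) x≡z))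
  where
  reversed : x ∷ p ++ [ z ] ≡ z ∷ (reverse p ∷ʳ x)
  reversed = trans pal (trans (List.unfold-reverse x (p ++ [ z ])) (cong (_∷ʳ x) (List.reverse-++ p [ z ])))
  x≡z : x ≡ z
  x≡z = proj₁ (List.∷-injective reversed)
  p∷ʳz≡ : p ++ [ z ] ≡ reverse p ∷ʳ x
  p∷ʳz≡ = proj₂ (List.∷-injective reversed)

longPal-peel : ∀ j x p z → longPal (2 + j) (x ∷ p ++ [ z ]) ≤ 𝟙 (x ≟ᶠ z) * longPal j p
longPal-peel j x p z = 𝟙-mono-× peel
  ((2 + j ≤? length (x ∷ p ++ [ z ])) ×-dec isPalindrome? (x ∷ p ++ [ z ])) (x ≟ᶠ z) ((j ≤? length p) ×-dec isPalindrome? p)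
  where
  peel : 2 + j ≤ length (x ∷ p ++ [ z ]) × IsPalindrome (x ∷ p ++ [ z ]) → x ≡ z × (j ≤ length p × IsPalindrome p)
  peel (long , pal) with palindrome-peel x p z pal
  ... | x≡z , palp = x≡z , (≤-pred (≤-pred (≤-trans long (≤-reflexive length-xpz))) , palp)
    where
    length-xpz : length (x ∷ p ++ [ z ]) ≡ 2 + length p
    length-xpz = cong suc (trans (List.length-++ p) (+-comm (length p) 1))

averaging : ∀ j w → ΣLetter (λ x → palPrefixes (2 + j) (x ∷ w)) ≤ longPal j [] + palPrefixes j w
averaging j w = begin
  ΣLetter (λ x → palPrefixes (2 + j) (x ∷ w))
    ≤⟨ ΣLetter-mono peelFirst ⟩
  ΣLetter (λ x → Σpositions (λ p z → 𝟙 (x ≟ᶠ z) * longPal j p) w)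
    ≡⟨ Σpositions-ΣLetter (λ x p z → 𝟙 (x ≟ᶠ z) * longPal j p) w ⟩
  Σpositions (λ p z → ΣLetter (λ x → 𝟙 (x ≟ᶠ z) * longPal j p)) w
    ≤⟨ Σpositions-mono (λ p z → ≤-reflexive (ΣLetter-≟ z (longPal j p))) w ⟩
  Σpositions (λ p _ → longPal j p) w
    ≤⟨ Σpositions-forget (longPal j) w ⟩
  longPal j [] + palPrefixes j w ∎
  where
  open ≤-Reasoning
  -- the one-letter prefix x is too short (longPal (2 + j) [ x ] computes to 0), and each longer
  -- prefix x · p · z is peeled to its middle p
  peelFirst : ∀ x → palPrefixes (2 + j) (x ∷ w) ≤ Σpositions (λ p z → 𝟙 (x ≟ᶠ z) * longPal j p) w
  peelFirst x = ≤-trans (≤-reflexive (Σprefixes-as-positions (λ q → longPal (2 + j) (x ∷ q)) w))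
                        (Σpositions-mono (longPal-peel j x) w)

-- Only the one-letter prefix is counted with threshold 1 but not with threshold 2.
palPrefixes-1≤ : ∀ u → palPrefixes 1 u ≤ 1 + palPrefixes 2 u
palPrefixes-1≤ []      = z≤n
palPrefixes-1≤ (y ∷ w) = +-mono-≤ (𝟙≤1 ((1 ≤? 1) ×-dec isPalindrome? [ y ]))
  (Σprefixes-mono (λ y′ q → longPal-raise 1 2 (y ∷ y′ ∷ q) (s≤s (s≤s z≤n))) w)

-- All counted prefixes are nonempty, so threshold 0 counts the same as threshold 1.
palPrefixes-0≤ : ∀ w → palPrefixes 0 w ≤ palPrefixes 1 w
palPrefixes-0≤ = Σprefixes-mono (λ y q → longPal-raise 0 1 (y ∷ q) (s≤s z≤n))

palPrefixes-total : ∀ n → ΣWords n (palPrefixes 1) ≤ 2 * 3 ^ n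
palPrefixes-total zero    = z≤n
palPrefixes-total (suc n) = begin
  ΣWords (suc n) (palPrefixes 1)
    ≤⟨ ΣWords-mono (suc n) palPrefixes-1≤ ⟩
  ΣWords (suc n) (λ u → 1 + palPrefixes 2 u)
    ≡⟨ trans (ΣWords-+ (suc n) (λ _ → 1) (palPrefixes 2)) (cong₂ _+_ (ΣWords-const (suc n) 1) (ΣWords-suc n (palPrefixes 2))) ⟩
  1 * 3 ^ suc n + ΣWords n (λ w → ΣLetter (λ x → palPrefixes 2 (x ∷ w)))
    ≤⟨ +-monoʳ-≤ (1 * 3 ^ suc n) (ΣWords-mono n (λ w → ≤-trans (averaging 0 w) (+-monoʳ-≤ 1 (palPrefixes-0≤ w)))) ⟩
  1 * 3 ^ suc n + ΣWords n (λ w → 1 + palPrefixes 1 w)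
    ≡⟨ cong (1 * 3 ^ suc n +_) (trans (ΣWords-+ n (λ _ → 1) (palPrefixes 1)) (cong (_+ ΣWords n (palPrefixes 1)) (ΣWords-const n 1))) ⟩
  1 * 3 ^ suc n + (1 * 3 ^ n + ΣWords n (palPrefixes 1))
    ≤⟨ +-monoʳ-≤ (1 * 3 ^ suc n) (+-monoʳ-≤ (1 * 3 ^ n) (palPrefixes-total n)) ⟩
  1 * (3 * 3 ^ n) + (1 * 3 ^ n + 2 * 3 ^ n)
    ≡⟨ rearrange (3 ^ n) ⟩
  2 * 3 ^ suc n ∎
  where
  open ≤-Reasoning
  rearrange : ∀ t → 1 * (3 * t) + (1 * t + 2 * t) ≡ 2 * (3 * t)
  rearrange = solve-∀

-- palOcc w: the number of occurrences (start position, length) of palindromic factors of w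
-- of length at least 3, grouped by start position.
palOcc : Word → ℕ
palOcc []      = 0
palOcc (x ∷ w) = palPrefixes 3 (x ∷ w) + palOcc w

-- Averaging over the first letter: the occurrences starting at position 0 are controlled by
-- the palindromic prefixes of the rest, the others are those of the rest.
palOcc-step : ∀ w → ΣLetter (λ x → palOcc (x ∷ w)) ≤ palPrefixes 1 w + 3 * palOcc w
palOcc-step w = begin
  ΣLetter (λ x → palOcc (x ∷ w))
    ≡⟨ ΣLetter-+ (λ x → palPrefixes 3 (x ∷ w)) (λ _ → palOcc w) ⟩
  ΣLetter (λ x → palPrefixes 3 (x ∷ w)) + 3 * palOcc w
    ≤⟨ +-monoˡ-≤ (3 * palOcc w) (averaging 1 w) ⟩
  palPrefixes 1 w + 3 * palOcc w ∎
  where open ≤-Reasoning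

palOcc-total : ∀ n → 3 * ΣWords n palOcc ≤ 2 * (n * 3 ^ n)
palOcc-total zero    = z≤n
palOcc-total (suc n) = begin
  3 * ΣWords (suc n) palOcc
    ≡⟨ cong (3 *_) (ΣWords-suc n palOcc) ⟩
  3 * ΣWords n (λ w → ΣLetter (λ x → palOcc (x ∷ w)))
    ≤⟨ *-monoʳ-≤ 3 (ΣWords-mono n palOcc-step) ⟩
  3 * ΣWords n (λ w → palPrefixes 1 w + 3 * palOcc w)
    ≡⟨ cong (3 *_) (trans (ΣWords-+ n (palPrefixes 1) (λ w → 3 * palOcc w)) (cong (ΣWords n (palPrefixes 1) +_) (ΣWords-* n 3 palOcc))) ⟩
  3 * (ΣWords n (palPrefixes 1) + 3 * ΣWords n palOcc)
    ≤⟨ *-monoʳ-≤ 3 (+-mono-≤ (palPrefixes-total n) (palOcc-total n)) ⟩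
  3 * (2 * 3 ^ n + 2 * (n * 3 ^ n))
    ≡⟨ rearrange n (3 ^ n) ⟩
  2 * (suc n * 3 ^ suc n) ∎
  where
  open ≤-Reasoning
  rearrange : ∀ n t → 3 * (2 * t + 2 * (n * t)) ≡ 2 * ((1 + n) * (3 * t))
  rearrange = solve-∀

palOcc-factors : ∀ u → sum (map (longPal 3) (factors u)) ≡ palOcc u
palOcc-factors u = trans (sum-map-concatMap (longPal 3) inits (tails u)) (bySuffix u)
  where
  bySuffix : ∀ u → sum (map (λ t → sum (map (longPal 3) (inits t))) (tails u)) ≡ palOcc u
  bySuffix []      = refl
  bySuffix (x ∷ w) = cong₂ _+_ (sum-inits (longPal 3) (x ∷ w)) (bySuffix w)

shortPalindromes : List Word
shortPalindromes = [ 0F ] ∷ [ 1F ] ∷ [ 2F ] ∷ (0F ∷ [ 0F ]) ∷ (1F ∷ [ 1F ]) ∷ (2F ∷ [ 2F ]) ∷ []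

short-palindrome-∈ : ∀ y → NonEmpty y → IsPalindrome y → ¬ (3 ≤ length y) → y ∈ shortPalindromes
short-palindrome-∈ []                ne _    _     = ⊥-elim (ne refl)
short-palindrome-∈ (0F ∷ [])         _  _    _     = here refl
short-palindrome-∈ (1F ∷ [])         _  _    _     = there (here refl)
short-palindrome-∈ (2F ∷ [])         _  _    _     = there (there (here refl))
short-palindrome-∈ (0F ∷ 0F ∷ [])    _  _    _     = there (there (there (here refl)))
short-palindrome-∈ (1F ∷ 1F ∷ [])    _  _    _     = there (there (there (there (here refl))))
short-palindrome-∈ (2F ∷ 2F ∷ [])    _  _    _     = there (there (there (there (there (here refl)))))
short-palindrome-∈ (0F ∷ 1F ∷ [])    _  ()   _
short-palindrome-∈ (0F ∷ 2F ∷ [])    _  ()   _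
short-palindrome-∈ (1F ∷ 0F ∷ [])    _  ()   _
short-palindrome-∈ (1F ∷ 2F ∷ [])    _  ()   _
short-palindrome-∈ (2F ∷ 0F ∷ [])    _  ()   _
short-palindrome-∈ (2F ∷ 1F ∷ [])    _  ()   _
short-palindrome-∈ (_ ∷ _ ∷ _ ∷ _)   _  _    short = ⊥-elim (short (s≤s (s≤s (s≤s z≤n))))

-- P(u) ≤ 6 + palOcc(u): the distinct palindromic factors are short ones or long occurrences.
P-bound : ∀ u → P u ≤ 6 + palOcc u
P-bound u = begin
  P u                                             ≤⟨ unique-⊆-length (deduplicate-! pals) shortOrLong ⟩
  length (shortPalindromes ++ filter long? pals)  ≡⟨ List.length-++ shortPalindromes {filter long? pals} ⟩
  6 + length (filter long? pals)                  ≤⟨ +-monoʳ-≤ 6 countLong ⟩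
  6 + sum (map (longPal 3) (factors u))           ≡⟨ cong (6 +_) (palOcc-factors u) ⟩
  6 + palOcc u                                    ∎
  where
  open ≤-Reasoning
  nonEmptyFactors pals : List Word
  nonEmptyFactors = filter nonEmpty? (factors u)
  pals            = filter isPalindrome? nonEmptyFactors
  long? : (w : Word) → Dec (3 ≤ length w)
  long? w = 3 ≤? length w
  shortOrLong : ∀ {y} → y ∈ deduplicate _≟w_ pals → y ∈ shortPalindromes ++ filter long? pals
  shortOrLong {y} y∈ with ∈-filter⁻ isPalindrome? {xs = nonEmptyFactors} (∈-deduplicate⁻ _≟w_ pals y∈)
  ... | y∈ne , pal with long? y
  ... | yes long  = ∈-++⁺ʳ shortPalindromes (∈-filter⁺ long? {xs = pals} (∈-deduplicate⁻ _≟w_ pals y∈) long)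
  ... | no ¬long  = ∈-++⁺ˡ (short-palindrome-∈ y (proj₂ (∈-filter⁻ nonEmpty? {xs = factors u} y∈ne)) pal ¬long)
  countLong : length (filter long? pals) ≤ sum (map (longPal 3) (factors u))
  countLong = begin
    length (filter long? pals)
      ≤⟨ length-filter-≤-sum long? (longPal 3) pals (λ {y} y∈ long →
           longPal-hit 3 y long (proj₂ (∈-filter⁻ isPalindrome? {xs = nonEmptyFactors} y∈))) ⟩
    sum (map (longPal 3) pals)
      ≤⟨ sum-map-filter-≤ isPalindrome? (longPal 3) nonEmptyFactors ⟩
    sum (map (longPal 3) nonEmptyFactors)
      ≤⟨ sum-map-filter-≤ nonEmpty? (longPal 3) (factors u) ⟩
    sum (map (longPal 3) (factors u)) ∎

S-bound : ∀ n → S n ≤ 6 * 3 ^ n + ΣWords n palOcc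
S-bound n = ≤-trans (ΣWords-mono n P-bound)
  (≤-reflexive (trans (ΣWords-+ n (λ _ → 6) palOcc) (cong (_+ ΣWords n palOcc) (ΣWords-const n 6))))

-- limsup M₃(n)/n ≤ 5/6 < 1: for n ≥ 36, 6 · S(n) ≤ 36 · 3^n + 4 · n · 3^n ≤ 5 · n · 3^n.
mainTheorem8 : Σ ℕ λ a → Σ ℕ λ b → Σ ℕ λ N →
    a < b × ((n : ℕ) → N ≤ n → b * S n ≤ a * (n * 3 ^ n))
mainTheorem8 = 5 , 6 , 36 , ≤-refl , bound
  where
  bound : (n : ℕ) → 36 ≤ n → 6 * S n ≤ 5 * (n * 3 ^ n)
  bound n 36≤n = begin
    6 * S n                                        ≤⟨ *-monoʳ-≤ 6 (S-bound n) ⟩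
    6 * (6 * 3 ^ n + ΣWords n palOcc)              ≡⟨ rearrange (3 ^ n) (ΣWords n palOcc) ⟩
    36 * 3 ^ n + 2 * (3 * ΣWords n palOcc)         ≤⟨ +-mono-≤ (*-monoˡ-≤ (3 ^ n) 36≤n) (*-monoʳ-≤ 2 (palOcc-total n)) ⟩
    n * 3 ^ n + 2 * (2 * (n * 3 ^ n))              ≡⟨ collect (n * 3 ^ n) ⟩
    5 * (n * 3 ^ n)                                ∎
    where
    open ≤-Reasoning
    rearrange : ∀ t X → 6 * (6 * t + X) ≡ 36 * t + 2 * (3 * X)
    rearrange = solve-∀
    collect : ∀ m → m + 2 * (2 * m) ≡ 5 * m
    collect = solve-∀
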